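{- For all formulas $\phi,\psi,\chi$ of $\mathcal{L}(W)$, the formula $W\psi\land\neg W(\phi\land\psi)\to W\big((W\chi\to\neg W(\phi\land\chi))\land\psi\big)$ is valid on the class of Euclidean frames.
   Context: Fix a nonempty set $\mathbf{P}$ of propositional variables. $\mathcal{L}(W)$: $\phi::=p\mid\neg\phi\mid(\phi\land\phi)\mid W\phi$ ($p\in\mathbf{P}$), other connectives as usual. A frame is $(S,R)$, $S\neq\emptyset$, $R\subseteq S\times S$; a model based on it adds $V:\mathbf{P}\to2^S$. Truth: Boolean clauses as usual; $\mathcal{M},s\vDash W\phi$ iff $\mathcal{M},s\nvDash\phi$ and $\mathcal{M},t\vDash\phi$ for all $t$ with $sRt$. A frame is Euclidean if $sRt$ and $sRu$ imply $tRu$. A formula is valid on a class of frames if it is true at every state of every model based on a frame in the class. -}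

module Defs where

open import Level using (Level; _⊔_; suc)
open import Data.Product using (_×_; ∃)
open import Relation.Nullary using (¬_)

data Form (P : Set) : Set where
  var  : P → Form P
  neg  : Form P → Form P
  conj : Form P → Form P → Form P
  W    : Form P → Form P

_⇒_ : {P : Set} → Form P → Form P → Form P
φ ⇒ ψ = neg (conj φ (neg ψ))

record Frame : Set₁ where
  field
    S        : Set
    R        : S → S → Set
    nonempty : S

open Frame public

Valuation : Set → Frame → Set₁
Valuation P F = P → S F → Set

_,_,_⊨_ : {P : Set} (F : Frame) → Valuation P F → S F → Form P → Set
F , V , s ⊨ var p      = V p s
F , V , s ⊨ neg φ      = ¬ (F , V , s ⊨ φ)
F , V , s ⊨ conj φ ψ   = (F , V , s ⊨ φ) × (F , V , s ⊨ ψ)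
F , V , s ⊨ W φ        = ¬ (F , V , s ⊨ φ) × (∀ t → R F s t → F , V , t ⊨ φ)

Euclidean : Frame → Set
Euclidean F = ∀ {s t u} → R F s t → R F s u → R F t u

ValidOn : {P : Set} → Frame → Form P → Set₁
ValidOn {P} F φ = (V : Valuation P F) (s : S F) → F , V , s ⊨ φ

{-# OPTIONS --safe #-}
-- In a Euclidean frame every successor t of a state satisfies t R t, and W χ
-- is false at a reflexive state, since it asks for χ to fail at t while
-- holding at all successors of t.
module Submission where

open import Defs
open import Data.Empty using (⊥-elim)
open import Data.Product using (_,_)
open import Function using (_∘_)
open import Relation.Nullary using (¬_)

euclidean-successor-reflexive : ∀ {F} → Euclidean F → ∀ s t → R F s t → R F t t
euclidean-successor-reflexive euc _ _ sRt = euc sRt sRt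

module Semantics {P : Set} (F : Frame) (V : Valuation P F) where

  ⊨⇒-intro : ∀ {s} (φ ψ : Form P) →
             (F , V , s ⊨ φ → F , V , s ⊨ ψ) → F , V , s ⊨ (φ ⇒ ψ)
  ⊨⇒-intro _ _ f (a , ¬b) = ¬b (f a)

  reflexive⇒¬W : ∀ t (φ : Form P) → R F t t → ¬ (F , V , t ⊨ W φ)
  reflexive⇒¬W _ _ tRt (¬φ , □φ) = ¬φ (□φ _ tRt)

  W-conjˡ : ∀ {s} (θ ψ : Form P) →
            (∀ t → R F s t → F , V , t ⊨ θ) →
            F , V , s ⊨ W ψ → F , V , s ⊨ W (conj θ ψ)
  W-conjˡ _ _ □θ (¬ψ , □ψ) = (λ (_ , ψ) → ¬ψ ψ) , λ t sRt → □θ t sRt , □ψ t sRt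

mainTheorem19 : {P : Set} → P → (φ ψ χ : Form P) → (F : Frame) → Euclidean F →
    ValidOn F ((conj (W ψ) (neg (W (conj φ ψ)))) ⇒ W (conj ((W χ) ⇒ neg (W (conj φ χ))) ψ))
mainTheorem19 _ φ ψ χ F euc V s =
  ⊨⇒-intro (conj (W ψ) (neg (W (conj φ ψ)))) (W (conj θ ψ))
    (λ (Wψ , _) → W-conjˡ θ ψ θ-at-successors Wψ)
  where
    open Semantics F V

    θ : Form _
    θ = W χ ⇒ neg (W (conj φ χ))

    θ-at-successors : ∀ t → R F s t → F , V , t ⊨ θ
    θ-at-successors t sRt =
      ⊨⇒-intro (W χ) (neg (W (conj φ χ)))
        (⊥-elim ∘ reflexive⇒¬W t χ (euclidean-successor-reflexive {F} euc s t sRt))
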